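{- For $t\in(\mathbb Z/2)^{\mathbb Z+\frac12}$ define $\eta(t)\in\mathbb B^L$ by: for $g=(s,n)\in L$, $\eta(t)_g=\top$ if and only if $s_{>n}=t_{>n}$. Then: - the map $t\mapsto\eta(t)$ is $L$-equivariant and surjective onto $\Omega_\leftarrow$; - it sends every $t$ for which $t_{>0}$ is infinitely supported to the constant configuration $\bot^L$; - it is injective on the set of $t$ with $t_{>0}$ finitely supported. In particular $\Omega_\leftarrow=\{\eta(t):t\in(\mathbb Z/2)^{\mathbb Z+\frac12}\}$. Moreover, the subshift $\Omega_\leftarrow$ is almost minimal.
   Context: **The group.** $L$ is the lamplighter group. Its elements are pairs $(s,n)$ with $n\in\mathbb Z$ and $s\colon\mathbb Z+\frac12\to\mathbb Z/2$ finitely supported. The product is $(r,m)(s,n)=(t,m+n)$ with $t_i=r_i+s_{i-m}$, and the generators are $a=(0,1)$, $b=(\delta_{1/2},1)$. For a function $s$ on $\mathbb Z+\frac12$, $s_{>n}$ denotes its restriction to $\{i>n\}$. **Actions.** $L$ acts on $(\mathbb Z/2)^{\mathbb Z+\frac12}$ by $((r,m)\cdot t)_j=t_{j-m}+r_j$. With $\mathbb B=\{\bot,\top\}$, $L$ acts on $\mathbb B^L$ (product topology) by $(g\eta)_h=\eta_{g^{ -1}h}$. **The subshift $\Omega_\leftarrow$.** $\Omega_\leftarrow$ is the set of $\eta\in\mathbb B^L$ such that for all $g\in L$, with $(\alpha,\beta,\gamma,\delta)=(\eta_g,\eta_{gab^{ -1}},\eta_{ga},\eta_{gb})$, one has $\alpha\vee\beta\Rightarrow\gamma\wedge\delta$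 and $\gamma\vee\delta\Rightarrow\alpha\ne\beta$. **Almost minimality.** A topological dynamical system $L\curvearrowright X$ on a compact metric space is almost minimal if it has a unique fixed point $0$ and every $x\ne0$ has dense orbit. -}

module Defs where

open import Level using (0ℓ)
open import Axiom.ExcludedMiddle using (ExcludedMiddle)
open import Data.Bool using (Bool; true; false; _xor_; _∧_; _∨_)
open import Data.Integer using (ℤ; +_; _+_; _-_; -_; _≤_)
open import Data.Integer.Properties using (_≟_)
open import Data.Nat using (ℕ) renaming (_≤_ to _≤ℕ_)
open import Data.List using (List; []; _∷_; _++_; map)
open import Data.List.Membership.Propositional using (_∈_)
open import Data.Product using (Σ; _×_; _,_; ∃)
open import Relation.Nullary using (¬_; does)
open import Relation.Binary.PropositionalEquality using (_≡_)

-- Conventions.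
-- * Z/2 and 𝔹 = {⊥,⊤} are both modelled by Bool (false = 0 = ⊥, true = 1 = ⊤).
-- * The half-integer i + 1/2 is represented by the integer i.  Hence
--   "j > n" for a half-integer j and an integer n becomes "n ≤ i",
--   and δ_{1/2} is supported at index 0.
Seq : Set
Seq = ℤ → Bool

-- A finitely supported function ℤ+1/2 → Z/2 is represented by a finite list
-- of positions; its value at i is the parity of the number of occurrences of i.
val : List ℤ → Seq
val []      i = false
val (j ∷ l) i = does (j ≟ i) xor val l i

record L : Set where
  constructor ⟨_,_⟩
  field
    sup : List ℤ
    pos : ℤ
open L public

seqOf : L → Seq
seqOf g = val (sup g)

-- Equality of group elements (the list representation is not canonical).
_≈L_ : L → L → Set
g ≈L h = (∀ i → seqOf g i ≡ seqOf h i) × pos g ≡ pos h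

-- Product (r,m)(s,n) = (t, m+n), t_i = r_i + s_{i-m}.
_·_ : L → L → L
⟨ r , m ⟩ · ⟨ s , n ⟩ = ⟨ r ++ map (λ j → j + m) s , m + n ⟩

_⁻¹ : L → L
⟨ s , n ⟩ ⁻¹ = ⟨ map (λ j → j - n) s , - n ⟩

a b : L
a = ⟨ [] , + 1 ⟩
b = ⟨ + 0 ∷ [] , + 1 ⟩

actSeq : L → Seq → Seq
actSeq g t j = t (j - pos g) xor seqOf g j

-- Configurations 𝔹^L.  Since L is a setoid, a genuine element of 𝔹^L
-- is a function respecting ≈L.
Config : Set
Config = L → Bool

Respects : Config → Set
Respects η = ∀ g h → g ≈L h → η g ≡ η h

actCfg : L → Config → Config
actCfg g η h = η ((g ⁻¹) · h)

LocalRule : Bool → Bool → Bool → Bool → Set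
LocalRule α β γ δ = ((α ∨ β) ≡ true → (γ ∧ δ) ≡ true)
                  × ((γ ∨ δ) ≡ true → (α xor β) ≡ true)

Ω← : Config → Set
Ω← η = Respects η
     × (∀ g → LocalRule (η g) (η (g · (a · (b ⁻¹)))) (η (g · a)) (η (g · b)))

botCfg : Config
botCfg _ = false

IsBot : Config → Set
IsBot x = ∀ h → x h ≡ false

-- The map t ↦ η(t): η(t)_(s,n) = ⊤ iff s_{>n} = t_{>n}.  The map is not
-- computable, so it is defined using excluded middle.
etaMap : ExcludedMiddle 0ℓ → Seq → Config
etaMap em t g = does (em {∀ i → pos g ≤ i → seqOf g i ≡ t i})

-- t_{>0} finitely supported (half-integers > 0 are indices + k, k ∈ ℕ).
RightFinSupp : Seq → Set
RightFinSupp t = Σ ℕ λ N → ∀ k → N ≤ℕ k → t (+ k) ≡ false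

RightInfSupp : Seq → Set
RightInfSupp t = ¬ RightFinSupp t

Fixed : Config → Set
Fixed x = ∀ g h → actCfg g x h ≡ x h

-- Orbit of x is dense in Ω← (product topology: every basic open set,
-- given by a finite set F ⊆ L and a pattern of some y ∈ Ω←, meets the orbit).
DenseOrbit : Config → Set
DenseOrbit x = ∀ y → Ω← y → ∀ (F : List L) →
               ∃ λ g → ∀ h → h ∈ F → actCfg g x h ≡ y h

AlmostMinimal : Set
AlmostMinimal =
    Ω← botCfg
  × Fixed botCfg
  × (∀ x → Ω← x → Fixed x → IsBot x)
  × (∀ x → Ω← x → ¬ IsBot x → DenseOrbit x)

module Submission where

-- Write s ≈ₙ t (AgreeFrom n) when s and t agree at all positions ≥ n, so that η(t) is ⊤
-- exactly at the cells (s , n) with s ≈ₙ t.  Since s ≈ₙ₊₁ t holds iff exactly one of s and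
-- its flip at n is ≈ₙ t, η(t) satisfies the local rule of Ω←; in fact the local rule says
-- precisely this about the ⊤-cells of any x ∈ Ω←: a ⊤-cell at level n+1 has exactly one
-- ⊤-child at level n, and both parents of a ⊤-cell are ⊤.  Following ⊤-children downwards
-- from one ⊤-cell of x produces a sequence t.  The local rule further shows that x at (s , n)
-- only depends on s from n on (flipping below n preserves ⊤), hence x = η(t).  Finally a
-- nonzero x is η(t) with t finitely supported to the right, and the translate by a finitely
-- supported lamp configuration turns t into any other such sequence beyond a given level,
-- which moves any finite window of x onto the corresponding window of any y ∈ Ω←.

open import Defs
open import Level using (0ℓ)
open import Axiom.ExcludedMiddle using (ExcludedMiddle)
open import Data.Bool using (true; false; not; _xor_; _∧_; _∨_; if_then_else_)
open import Data.Bool.Properties using (xor-comm; xor-assoc; xor-same; xor-identityʳ; not-involutive; not-¬; ¬-not)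
  renaming (_≟_ to _≟ᵇ_)
open import Data.Integer using (ℤ; +_; -[1+_]; _+_; _-_; -_; _≤_; _<_; _⊔_; ∣_∣; +≤+; -≤+)
import Data.Integer.Properties as ℤP
open ℤP using (_≟_; _<?_)
open import Data.Integer.Tactic.RingSolver using (solve-∀)
open import Data.Nat using (ℕ; zero; suc; _∸_) renaming (_≤_ to _≤ℕ_; _+_ to _+ℕ_)
import Data.Nat.Properties as ℕP
open import Data.List using (List; []; _∷_; _++_; map; filter)
open import Data.List.Membership.Propositional using (_∈_)
open import Data.List.Relation.Unary.All as All using (All; []; _∷_)
open import Data.List.Relation.Unary.All.Properties using (all-filter; map⁻)
open import Data.List.Extrema ℤP.≤-totalOrder using (max; min; xs≤max; min≤xs)
open import Data.Product using (_×_; _,_; ∃; proj₁; proj₂)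
open import Data.Sum using (_⊎_; inj₁; inj₂)
open import Function.Base using (_∘_)
open import Function.Bundles using (_⇔_; mk⇔; Equivalence)
open import Relation.Nullary using (¬_; Dec; yes; no; does; contradiction)
open import Relation.Nullary.Decidable using (dec-true; dec-false; does-⇔; _⊎-dec_; _×-dec_; decidable-stable)
open import Relation.Binary.PropositionalEquality
  using (_≡_; refl; sym; trans; cong; cong₂; subst; module ≡-Reasoning)

open Equivalence using (to; from)

∨≡true⇒ : ∀ {x y} → x ∨ y ≡ true → x ≡ true ⊎ y ≡ true
∨≡true⇒ {true}  _ = inj₁ refl
∨≡true⇒ {false} e = inj₂ e

xor-cancelˡ : ∀ x y → x xor (x xor y) ≡ y
xor-cancelˡ false y = refl
xor-cancelˡ true  y = not-involutive y

xor-cancelʳ : ∀ x y → (x xor y) xor y ≡ x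
xor-cancelʳ x y = trans (xor-assoc x y y) (trans (cong (x xor_) (xor-same y)) (xor-identityʳ x))

xor-cancel-middle : ∀ p q r → p xor (q xor (p xor r)) ≡ q xor r
xor-cancel-middle false q r = refl
xor-cancel-middle true false r = not-involutive r
xor-cancel-middle true true  r = cong not (not-involutive r)

does≡true⇒ : ∀ {A : Set} (a? : Dec A) → does a? ≡ true → A
does≡true⇒ (yes a) _ = a

≤⇒≡+ : ∀ {m n} → m ≤ n → ∃ λ k → n ≡ m + + k
≤⇒≡+ {m} {n} m≤n = ∣ m - n ∣ , sym (trans (cong (λ j → m + j) (ℤP.∣-∣-≤ m≤n)) (e m n))
  where e : ∀ m n → m + (n - m) ≡ n
        e = solve-∀

i≤+∣i∣ : ∀ i → i ≤ + ∣ i ∣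
i≤+∣i∣ (+ n)    = ℤP.≤-refl
i≤+∣i∣ -[1+ n ] = -≤+

∃≤+ : ∀ m n → ∃ λ d → m ≤ n + + d
∃≤+ m n = ∣ m - n ∣ , ℤP.≤-trans (ℤP.≤-reflexive (sym (e m n))) (ℤP.+-monoʳ-≤ n (i≤+∣i∣ (m - n)))
  where e : ∀ m n → n + (m - n) ≡ m
        e = solve-∀

<⇒+1≤ : ∀ {m n} → m < n → m + + 1 ≤ n
<⇒+1≤ {m} m<n = subst (_≤ _) (ℤP.+-comm (+ 1) m) (ℤP.i<j⇒suc[i]≤j m<n)

+1≤⇒< : ∀ {m n} → m + + 1 ≤ n → m < n
+1≤⇒< {m} p = ℤP.suc[i]≤j⇒i<j (subst (_≤ _) (ℤP.+-comm m (+ 1)) p)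

+-suc : ∀ m k → m + + suc k ≡ (m + + k) + + 1
+-suc m k = trans (cong (λ j → m + j) (ℤP.pos-+ 1 k)) (e m (+ k))
  where e : ∀ m j → m + (+ 1 + j) ≡ (m + j) + + 1
        e = solve-∀

+-suc-shift : ∀ m k → m + + suc k ≡ (m + + 1) + + k
+-suc-shift m k = trans (cong (λ j → m + j) (ℤP.pos-+ 1 k)) (sym (ℤP.+-assoc m (+ 1) (+ k)))

upward-induction : ∀ {P : ℤ → Set} {m} → P m → (∀ n → P n → P (n + + 1)) → ∀ n → m ≤ n → P n
upward-induction {P} {m} base step n m≤n with ≤⇒≡+ m≤n
... | k , refl = go k
  where
  go : ∀ k → P (m + + k)
  go zero    = subst P (sym (ℤP.+-identityʳ m)) base
  go (suc k) = subst P (sym (+-suc m k)) (step _ (go k))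

downward-induction : ∀ {P : ℤ → Set} m → (∀ n → m ≤ n → P n) → (∀ n → P (n + + 1) → P n) → ∀ n → P n
downward-induction {P} m base step n = go (proj₁ (∃≤+ m n)) n (proj₂ (∃≤+ m n))
  where
  go : ∀ d n → m ≤ n + + d → P n
  go zero    n p = base n (subst (m ≤_) (ℤP.+-identityʳ n) p)
  go (suc d) n p = step n (go d (n + + 1) (subst (m ≤_) (+-suc-shift n d) p))

upper-bound : ∀ {A : Set} (f : A → ℤ) (F : List A) → ∃ λ M → ∀ {h} → h ∈ F → f h ≤ M
upper-bound f F = max (+ 0) (map f F) , All.lookup (map⁻ (xs≤max (+ 0) (map f F)))

lower-bound : ∀ {A : Set} (f : A → ℤ) (F : List A) → ∃ λ m → ∀ {h} → h ∈ F → m ≤ f h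
lower-bound f F = min (+ 0) (map f F) , All.lookup (map⁻ (min≤xs (+ 0) (map f F)))

-- Agreement of sequences from a position on

AgreeFrom : ℤ → Seq → Seq → Set
AgreeFrom n f g = ∀ i → n ≤ i → f i ≡ g i

VanishesFrom : ℤ → Seq → Set
VanishesFrom n f = AgreeFrom n f (λ _ → false)

-- flipAt n (val s) is definitionally val (n ∷ s).
flipAt : ℤ → Seq → Seq
flipAt n f i = does (n ≟ i) xor f i

agree-sym : ∀ {n f g} → AgreeFrom n f g → AgreeFrom n g f
agree-sym A i p = sym (A i p)

agree-trans : ∀ {n f g h} → AgreeFrom n f g → AgreeFrom n g h → AgreeFrom n f h
agree-trans A B i p = trans (A i p) (B i p)

agree-mono : ∀ {m n f g} → m ≤ n → AgreeFrom m f g → AgreeFrom n f g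
agree-mono m≤n A i p = A i (ℤP.≤-trans m≤n p)

agree-cong : ∀ {m n f f′ g} → (∀ i → f i ≡ f′ i) → m ≡ n → AgreeFrom m f g → AgreeFrom n f′ g
agree-cong e refl A i p = trans (sym (e i)) (A i p)

flipAt-agree : ∀ n f → AgreeFrom (n + + 1) (flipAt n f) f
flipAt-agree n f i p = cong (_xor f i) (dec-false (n ≟ i) (ℤP.<⇒≢ (+1≤⇒< p)))

agree-extend : ∀ {n f g} → AgreeFrom (n + + 1) f g → f n ≡ g n → AgreeFrom n f g
agree-extend {n} A e i p with n ≟ i
... | yes refl = e
... | no n≢i   = A i (<⇒+1≤ (ℤP.≤∧≢⇒< p n≢i))

¬agree-flipAt : ∀ {n f g} → AgreeFrom n f g → ¬ AgreeFrom n (flipAt n f) g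
¬agree-flipAt {n} {f} A B = not-¬ refl (begin
  f n           ≡⟨ trans (A n ℤP.≤-refl) (sym (B n ℤP.≤-refl)) ⟩
  flipAt n f n  ≡⟨ cong (_xor f n) (dec-true (n ≟ n) refl) ⟩
  not (f n)     ∎)
  where open ≡-Reasoning

agree-suc⇔ : ∀ {n f g} → AgreeFrom (n + + 1) f g ⇔ (AgreeFrom n f g ⊎ AgreeFrom n (flipAt n f) g)
agree-suc⇔ {n} {f} {g} = mk⇔ split merge
  where
  split : AgreeFrom (n + + 1) f g → AgreeFrom n f g ⊎ AgreeFrom n (flipAt n f) g
  split A with f n ≟ᵇ g n
  ... | yes e = inj₁ (agree-extend A e)
  ... | no ne = inj₂ (agree-extend (agree-trans (flipAt-agree n f) A)
                                   (trans (cong (_xor f n) (dec-true (n ≟ n) refl)) (sym (¬-not (ne ∘ sym)))))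
  merge : AgreeFrom n f g ⊎ AgreeFrom n (flipAt n f) g → AgreeFrom (n + + 1) f g
  merge (inj₁ A) = agree-mono (ℤP.i≤i+j n (+ 1)) A
  merge (inj₂ B) = agree-trans (agree-sym (flipAt-agree n f)) (agree-mono (ℤP.i≤i+j n (+ 1)) B)

-- Finitely supported sequences

val-++ : ∀ l m i → val (l ++ m) i ≡ val l i xor val m i
val-++ []      m i = refl
val-++ (j ∷ l) m i = trans (cong (does (j ≟ i) xor_) (val-++ l m i)) (sym (xor-assoc (does (j ≟ i)) (val l i) (val m i)))

val-∷ʳ : ∀ l j i → val (l ++ j ∷ []) i ≡ val (j ∷ l) i
val-∷ʳ l j i = begin
  val (l ++ j ∷ []) i                  ≡⟨ val-++ l (j ∷ []) i ⟩
  val l i xor (does (j ≟ i) xor false) ≡⟨ cong (val l i xor_) (xor-identityʳ _) ⟩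
  val l i xor does (j ≟ i)             ≡⟨ xor-comm (val l i) _ ⟩
  val (j ∷ l) i                        ∎
  where open ≡-Reasoning

val-shift : ∀ c l i → val (map (λ j → j + c) l) i ≡ val l (i - c)
val-shift c []      i = refl
val-shift c (j ∷ l) i = cong₂ _xor_ (does-⇔ (mk⇔ to′ from′) (j + c ≟ i) (j ≟ i - c)) (val-shift c l i)
  where
  cancel₁ : ∀ j c → (j + c) - c ≡ j
  cancel₁ = solve-∀
  cancel₂ : ∀ i c → (i - c) + c ≡ i
  cancel₂ = solve-∀
  to′ : j + c ≡ i → j ≡ i - c
  to′ refl = sym (cancel₁ j c)
  from′ : j ≡ i - c → j + c ≡ i
  from′ refl = cancel₂ i c

supportBound : List ℤ → ℤ
supportBound []      = + 0
supportBound (j ∷ l) = (j + + 1) ⊔ supportBound l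

val-vanishes : ∀ l → VanishesFrom (supportBound l) (val l)
val-vanishes []      i p = refl
val-vanishes (j ∷ l) i p =
  cong₂ _xor_ (dec-false (j ≟ i) (ℤP.<⇒≢ (+1≤⇒< (ℤP.i⊔j≤k⇒i≤k (j + + 1) _ p))))
              (val-vanishes l i (ℤP.i⊔j≤k⇒j≤k (j + + 1) _ p))

module _ {P : ℤ → Set} (P? : ∀ i → Dec (P i)) where

  val-filter-kept : ∀ l {i} → P i → val (filter P? l) i ≡ val l i
  val-filter-kept []      _  = refl
  val-filter-kept (j ∷ l) {i} Pi with P? j
  ... | yes _  = cong (does (j ≟ i) xor_) (val-filter-kept l Pi)
  ... | no ¬Pj = trans (val-filter-kept l Pi) (cong (_xor val l i) (sym (dec-false (j ≟ i) λ { refl → ¬Pj Pi })))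

  val-filter-dropped : ∀ l {i} → ¬ P i → val (filter P? l) i ≡ false
  val-filter-dropped []      _  = refl
  val-filter-dropped (j ∷ l) {i} ¬Pi with P? j
  ... | yes Pj = cong₂ _xor_ (dec-false (j ≟ i) (λ { refl → ¬Pi Pj })) (val-filter-dropped l ¬Pi)
  ... | no _   = val-filter-dropped l ¬Pi

rightFinSupp⇒vanishes : ∀ t → RightFinSupp t → ∃ λ M → VanishesFrom M t
rightFinSupp⇒vanishes _ (N , vanish) = + N , λ { (+ k) (+≤+ N≤k) → vanish k N≤k }

vanishes⇒rightFinSupp : ∀ t {M} → VanishesFrom M t → RightFinSupp t
vanishes⇒rightFinSupp _ {M} vanish = ∣ M ∣ , λ k p → vanish (+ k) (ℤP.≤-trans (i≤+∣i∣ M) (+≤+ p))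

finite-tail : ∀ {f M} → VanishesFrom M f → ∀ n → ∃ λ r → AgreeFrom n (val r) f
finite-tail {f} {M} vanish = downward-induction M base step
  where
  base : ∀ n → M ≤ n → ∃ λ r → AgreeFrom n (val r) f
  base n M≤n = [] , agree-sym (agree-mono M≤n vanish)
  step : ∀ n → (∃ λ r → AgreeFrom (n + + 1) (val r) f) → ∃ λ r → AgreeFrom n (val r) f
  step n (r , A) with to agree-suc⇔ A
  ... | inj₁ B = r , B
  ... | inj₂ B = n ∷ r , B

translate-tail : ∀ t t′ → RightFinSupp t → RightFinSupp t′ → ∀ n → ∃ λ g → AgreeFrom n (actSeq g t) t′
translate-tail t t′ t-fin t′-fin n = ⟨ r , + 0 ⟩ , λ j p → begin
  t (j - + 0) xor val r j   ≡⟨ cong₂ _xor_ (cong t (ℤP.+-identityʳ j)) (r≈t+t′ j p) ⟩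
  t j xor (t j xor t′ j)    ≡⟨ xor-cancelˡ (t j) (t′ j) ⟩
  t′ j                      ∎
  where
  open ≡-Reasoning
  M = proj₁ (rightFinSupp⇒vanishes t t-fin)
  M′ = proj₁ (rightFinSupp⇒vanishes t′ t′-fin)
  vanish : VanishesFrom (M ⊔ M′) (λ j → t j xor t′ j)
  vanish j p = cong₂ _xor_ (proj₂ (rightFinSupp⇒vanishes t t-fin) j (ℤP.i⊔j≤k⇒i≤k M M′ p))
                           (proj₂ (rightFinSupp⇒vanishes t′ t′-fin) j (ℤP.i⊔j≤k⇒j≤k M M′ p))
  r = proj₁ (finite-tail vanish n)
  r≈t+t′ = proj₂ (finite-tail vanish n)

-- The local rule of Ω←

localRule-intro : ∀ {α β γ δ} → γ ≡ α ∨ β → δ ≡ α ∨ β → α ∧ β ≡ false → LocalRule α β γ δ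
localRule-intro {true}  {false} refl refl _ = (λ _ → refl) , (λ _ → refl)
localRule-intro {false} {true}  refl refl _ = (λ _ → refl) , (λ _ → refl)
localRule-intro {false} {false} refl refl _ = (λ ()) , (λ ())

localRule-elim : ∀ {α β γ δ} → LocalRule α β γ δ → γ ≡ α ∨ β × δ ≡ α ∨ β × α ∧ β ≡ false
localRule-elim {false} {false} {false} {false} _       = refl , refl , refl
localRule-elim {false} {false} {true}  {_}     (_ , r) = contradiction (r refl) λ ()
localRule-elim {false} {false} {false} {true}  (_ , r) = contradiction (r refl) λ ()
localRule-elim {true}  {false} {true}  {true}  _       = refl , refl , refl
localRule-elim {false} {true}  {true}  {true}  _       = refl , refl , refl
localRule-elim {true}  {true}  {true}  {true}  (_ , r) = contradiction (r refl) λ ()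
localRule-elim {true}  {_}     {false} {_}     (l , _) = contradiction (l refl) λ ()
localRule-elim {true}  {_}     {true}  {false} (l , _) = contradiction (l refl) λ ()
localRule-elim {false} {true}  {false} {_}     (l , _) = contradiction (l refl) λ ()
localRule-elim {false} {true}  {true}  {false} (l , _) = contradiction (l refl) λ ()

localRule-cong : ∀ {α β β′ γ γ′ δ δ′} → β ≡ β′ → γ ≡ γ′ → δ ≡ δ′ →
                 LocalRule α β γ δ → LocalRule α β′ γ′ δ′
localRule-cong refl refl refl r = r

seq-·a : ∀ s n i → seqOf (⟨ s , n ⟩ · a) i ≡ val s i
seq-·a s n i = trans (val-++ s [] i) (xor-identityʳ (val s i))

seq-·b : ∀ s n i → seqOf (⟨ s , n ⟩ · b) i ≡ val (n ∷ s) i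
seq-·b s n i = trans (val-∷ʳ s (+ 0 + n) i) (cong (λ j → val (j ∷ s) i) (ℤP.+-identityˡ n))

seq-·ab⁻¹ : ∀ s n i → seqOf (⟨ s , n ⟩ · (a · (b ⁻¹))) i ≡ val (n ∷ s) i
seq-·ab⁻¹ = seq-·b

seq-⁻¹· : ∀ r m s n i → seqOf ((⟨ r , m ⟩ ⁻¹) · ⟨ s , n ⟩) i ≡ val r (i + m) xor val s (i + m)
seq-⁻¹· r m s n i = begin
  seqOf ((⟨ r , m ⟩ ⁻¹) · ⟨ s , n ⟩) i
    ≡⟨ val-++ (map (λ j → j - m) r) (map (λ j → j - m) s) i ⟩
  val (map (λ j → j - m) r) i xor val (map (λ j → j - m) s) i
    ≡⟨ cong₂ _xor_ (val-shift (- m) r i) (val-shift (- m) s i) ⟩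
  val r (i - - m) xor val s (i - - m)
    ≡⟨ cong (λ j → val r j xor val s j) (cong (λ k → i + k) (ℤP.neg-involutive m)) ⟩
  val r (i + m) xor val s (i + m) ∎
  where open ≡-Reasoning

LocalRuleAt : Config → List ℤ → ℤ → Set
LocalRuleAt x s n = LocalRule (x ⟨ s , n ⟩) (x ⟨ n ∷ s , n ⟩) (x ⟨ s , n + + 1 ⟩) (x ⟨ n ∷ s , n + + 1 ⟩)

module _ {x : Config} (x-resp : Respects x) (s : List ℤ) (n : ℤ) where

  x-·ab⁻¹ : x (⟨ s , n ⟩ · (a · (b ⁻¹))) ≡ x ⟨ n ∷ s , n ⟩
  x-·ab⁻¹ = x-resp _ _ (seq-·ab⁻¹ s n , ℤP.+-identityʳ n)

  x-·a : x (⟨ s , n ⟩ · a) ≡ x ⟨ s , n + + 1 ⟩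
  x-·a = x-resp _ _ (seq-·a s n , refl)

  x-·b : x (⟨ s , n ⟩ · b) ≡ x ⟨ n ∷ s , n + + 1 ⟩
  x-·b = x-resp _ _ (seq-·b s n , refl)

Ω←-intro : ∀ {x} → Respects x → (∀ s n → LocalRuleAt x s n) → Ω← x
Ω←-intro x-resp rule = x-resp , λ where
  ⟨ s , n ⟩ → localRule-cong (sym (x-·ab⁻¹ x-resp s n)) (sym (x-·a x-resp s n)) (sym (x-·b x-resp s n)) (rule s n)

Ω←-elim : ∀ {x} → Ω← x → ∀ s n → LocalRuleAt x s n
Ω←-elim (x-resp , rule) s n = localRule-cong (x-·ab⁻¹ x-resp s n) (x-·a x-resp s n) (x-·b x-resp s n) (rule ⟨ s , n ⟩)

-- The map t ↦ η(t)

module _ (em : ExcludedMiddle 0ℓ) where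

  eta-true : ∀ t h → AgreeFrom (pos h) (seqOf h) t → etaMap em t h ≡ true
  eta-true _ _ = dec-true em

  eta-false : ∀ t h → ¬ AgreeFrom (pos h) (seqOf h) t → etaMap em t h ≡ false
  eta-false _ _ = dec-false em

  eta-true⁻¹ : ∀ t h → etaMap em t h ≡ true → AgreeFrom (pos h) (seqOf h) t
  eta-true⁻¹ _ _ = does≡true⇒ em

  eta-tail : ∀ {t t′} h → AgreeFrom (pos h) t t′ → etaMap em t h ≡ etaMap em t′ h
  eta-tail h A = does-⇔ (mk⇔ (λ B → agree-trans B A) (λ B → agree-trans B (agree-sym A))) em em

  eta-equivariant : ∀ g t h → etaMap em (actSeq g t) h ≡ actCfg g (etaMap em t) h
  eta-equivariant ⟨ r , m ⟩ t ⟨ s , n ⟩ = does-⇔ (mk⇔ to′ from′) em em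
    where
    g⁻¹h = (⟨ r , m ⟩ ⁻¹) · ⟨ s , n ⟩
    shift-≤ : ∀ {i} → - m + n ≤ i → n ≤ i + m
    shift-≤ {i} p = subst (_≤ i + m) (e m n) (ℤP.+-monoˡ-≤ m p)
      where e : ∀ m n → (- m + n) + m ≡ n
            e = solve-∀
    unshift-≤ : ∀ {j} → n ≤ j → - m + n ≤ j - m
    unshift-≤ {j} p = subst (_≤ j - m) (ℤP.+-comm n (- m)) (ℤP.+-monoˡ-≤ (- m) p)
    cancel₁ : ∀ i m → (i + m) - m ≡ i
    cancel₁ = solve-∀
    cancel₂ : ∀ j m → (j - m) + m ≡ j
    cancel₂ = solve-∀
    open ≡-Reasoning
    to′ : AgreeFrom n (val s) (actSeq ⟨ r , m ⟩ t) → AgreeFrom (- m + n) (seqOf g⁻¹h) t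
    to′ A i p = begin
      seqOf g⁻¹h i                          ≡⟨ seq-⁻¹· r m s n i ⟩
      ρ xor val s (i + m)                   ≡⟨ cong (ρ xor_) (A (i + m) (shift-≤ p)) ⟩
      ρ xor (t (i + m - m) xor ρ)           ≡⟨ cong (ρ xor_) (xor-comm _ ρ) ⟩
      ρ xor (ρ xor t (i + m - m))           ≡⟨ xor-cancelˡ ρ _ ⟩
      t (i + m - m)                         ≡⟨ cong t (cancel₁ i m) ⟩
      t i                                   ∎
      where ρ = val r (i + m)
    from′ : AgreeFrom (- m + n) (seqOf g⁻¹h) t → AgreeFrom n (val s) (actSeq ⟨ r , m ⟩ t)
    from′ B j p = begin
      val s j                               ≡⟨ sym (xor-cancelˡ (val r j) (val s j)) ⟩
      val r j xor (val r j xor val s j)     ≡⟨ cong (val r j xor_) (trans (sym seq-at) (B (j - m) (unshift-≤ p))) ⟩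
      val r j xor t (j - m)                 ≡⟨ xor-comm (val r j) _ ⟩
      actSeq ⟨ r , m ⟩ t j                  ∎
      where
      seq-at : seqOf g⁻¹h (j - m) ≡ val r j xor val s j
      seq-at = trans (seq-⁻¹· r m s n (j - m)) (cong (λ i → val r i xor val s i) (cancel₂ j m))

  eta-respects : ∀ t → Respects (etaMap em t)
  eta-respects t g h (seq-eq , pos-eq) =
    does-⇔ (mk⇔ (agree-cong seq-eq pos-eq) (agree-cong (sym ∘ seq-eq) (sym pos-eq))) em em

  eta∈Ω← : ∀ t → Ω← (etaMap em t)
  eta∈Ω← t = Ω←-intro (eta-respects t) λ s n →
    localRule-intro {etaMap em t ⟨ s , n ⟩} {etaMap em t ⟨ n ∷ s , n ⟩}
                    (does-⇔ (agree-suc⇔ {n} {val s} {t}) em (em ⊎-dec em))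
                    (does-⇔ (flip-suc⇔ s n) em (em ⊎-dec em))
                    (dec-false (em ×-dec em) λ (A , B) → ¬agree-flipAt A B)
    where
    flip-suc⇔ : ∀ s n → AgreeFrom (n + + 1) (val (n ∷ s)) t ⇔
                        (AgreeFrom n (val s) t ⊎ AgreeFrom n (val (n ∷ s)) t)
    flip-suc⇔ s n = mk⇔ (λ A → to agree-suc⇔ (agree-trans (agree-sym (flipAt-agree n (val s))) A))
                        (λ A⊎B → agree-trans (flipAt-agree n (val s)) (from agree-suc⇔ A⊎B))

  infSupp⇒bot : ∀ t → RightInfSupp t → IsBot (etaMap em t)
  infSupp⇒bot t t-inf ⟨ s , n ⟩ = eta-false t ⟨ s , n ⟩ λ A →
    t-inf (vanishes⇒rightFinSupp t (λ i p →
      trans (sym (A i (ℤP.i⊔j≤k⇒j≤k (supportBound s) n p))) (val-vanishes s i (ℤP.i⊔j≤k⇒i≤k (supportBound s) n p))))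

  eta-injective : ∀ t t′ → RightFinSupp t → RightFinSupp t′ →
                  (∀ h → etaMap em t h ≡ etaMap em t′ h) → ∀ i → t i ≡ t′ i
  eta-injective t t′ t-fin _ eta-eq i = trans (sym (r≈t i ℤP.≤-refl)) (r≈t′ i ℤP.≤-refl)
    where
    r = proj₁ (finite-tail (proj₂ (rightFinSupp⇒vanishes t t-fin)) i)
    r≈t = proj₂ (finite-tail (proj₂ (rightFinSupp⇒vanishes t t-fin)) i)
    r≈t′ : AgreeFrom i (val r) t′
    r≈t′ = eta-true⁻¹ t′ ⟨ r , i ⟩ (trans (sym (eta-eq ⟨ r , i ⟩)) (eta-true t ⟨ r , i ⟩ r≈t))

-- Points of Ω←

module InΩ← {x : Config} (x∈Ω : Ω← x) where

  x-cong : ∀ {u v m n} → (∀ i → val u i ≡ val v i) → m ≡ n → x ⟨ u , m ⟩ ≡ x ⟨ v , n ⟩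
  x-cong e m≡n = proj₁ x∈Ω _ _ (e , m≡n)

  private
    rule : ∀ u n → x ⟨ u , n + + 1 ⟩ ≡ x ⟨ u , n ⟩ ∨ x ⟨ n ∷ u , n ⟩
                 × x ⟨ n ∷ u , n + + 1 ⟩ ≡ x ⟨ u , n ⟩ ∨ x ⟨ n ∷ u , n ⟩
                 × x ⟨ u , n ⟩ ∧ x ⟨ n ∷ u , n ⟩ ≡ false
    rule u n = localRule-elim {x ⟨ u , n ⟩} {x ⟨ n ∷ u , n ⟩} (Ω←-elim x∈Ω u n)

  raise : ∀ {u n} → x ⟨ u , n ⟩ ≡ true → x ⟨ u , n + + 1 ⟩ ≡ true
  raise {u} {n} h = trans (proj₁ (rule u n)) (cong (_∨ x ⟨ n ∷ u , n ⟩) h)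

  raise-flip : ∀ {u n} → x ⟨ u , n ⟩ ≡ true → x ⟨ n ∷ u , n + + 1 ⟩ ≡ true
  raise-flip {u} {n} h = trans (proj₁ (proj₂ (rule u n))) (cong (_∨ x ⟨ n ∷ u , n ⟩) h)

  flip-false : ∀ {u n} → x ⟨ u , n ⟩ ≡ true → x ⟨ n ∷ u , n ⟩ ≡ false
  flip-false {u} {n} h = trans (sym (cong (_∧ x ⟨ n ∷ u , n ⟩) h)) (proj₂ (proj₂ (rule u n)))

  lower : ∀ {u n} → x ⟨ u , n + + 1 ⟩ ≡ true → x ⟨ u , n ⟩ ≡ true ⊎ x ⟨ n ∷ u , n ⟩ ≡ true
  lower {u} {n} h = ∨≡true⇒ (trans (sym (proj₁ (rule u n))) h)

  raise* : ∀ {u m n} → m ≤ n → x ⟨ u , m ⟩ ≡ true → x ⟨ u , n ⟩ ≡ true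
  raise* {u} {n = n} m≤n h = upward-induction {λ n → x ⟨ u , n ⟩ ≡ true} h (λ _ → raise) n m≤n

  flip-at-pred : ∀ {k u} → x ⟨ u , k + + 1 ⟩ ≡ true → x ⟨ k ∷ u , k + + 1 ⟩ ≡ true
  flip-at-pred h with lower h
  ... | inj₁ h′ = raise-flip h′
  ... | inj₂ h′ = raise h′

  flip-below : ∀ {k n} → k < n → ∀ {u} → x ⟨ u , n ⟩ ≡ true → x ⟨ k ∷ u , n ⟩ ≡ true
  flip-below {k} {n} k<n = upward-induction {P} flip-at-pred step n (<⇒+1≤ k<n)
    where
    P : ℤ → Set
    P m = ∀ {u} → x ⟨ u , m ⟩ ≡ true → x ⟨ k ∷ u , m ⟩ ≡ true
    -- If the ⊤-child is m ∷ u: flip k there, raise, and undo the flip at m.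
    step : ∀ m → P m → P (m + + 1)
    step m ih {u} h with lower h
    ... | inj₁ h′ = raise (ih h′)
    ... | inj₂ h′ = trans (x-cong {k ∷ u} {m ∷ k ∷ m ∷ u} (λ i → sym (xor-cancel-middle (does (m ≟ i)) (does (k ≟ i)) _)) refl)
                          (flip-at-pred (raise (ih h′)))

  flips-below : ∀ {n u l} → All (_< n) l → x ⟨ u , n ⟩ ≡ true → x ⟨ l ++ u , n ⟩ ≡ true
  flips-below []           h = h
  flips-below (k<n ∷ k<ns) h = flip-below k<n (flips-below k<ns h)

  tail-determines : ∀ {u v n} → AgreeFrom n (val u) (val v) → x ⟨ u , n ⟩ ≡ true → x ⟨ v , n ⟩ ≡ true
  tail-determines {u} {v} {n} A h = trans (sym (x-cong same-val refl)) (flips-below (all-filter (_<? n) (v ++ u)) h)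
    where
    -- u and v can only differ at entries of v ++ u, and those below n may be flipped.
    w = filter (_<? n) (v ++ u)
    open ≡-Reasoning
    same-val : ∀ i → val (w ++ u) i ≡ val v i
    same-val i with i <? n
    ... | yes i<n = begin
      val (w ++ u) i                    ≡⟨ val-++ w u i ⟩
      val w i xor val u i               ≡⟨ cong (_xor val u i) (val-filter-kept (_<? n) (v ++ u) i<n) ⟩
      val (v ++ u) i xor val u i        ≡⟨ cong (_xor val u i) (val-++ v u i) ⟩
      (val v i xor val u i) xor val u i ≡⟨ xor-cancelʳ (val v i) (val u i) ⟩
      val v i                           ∎
    ... | no i≮n = begin
      val (w ++ u) i                    ≡⟨ val-++ w u i ⟩
      val w i xor val u i               ≡⟨ cong (_xor val u i) (val-filter-dropped (_<? n) (v ++ u) i≮n) ⟩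
      val u i                           ≡⟨ A i (ℤP.≮⇒≥ i≮n) ⟩
      val v i                           ∎

  fixed⇒bot : Fixed x → IsBot x
  fixed⇒bot fixed ⟨ s , n ⟩ with x ⟨ s , n ⟩ in e
  ... | false = refl
  ... | true  = contradiction (trans (sym (flip-false e)) flipped-true) λ ()
    where
    g = ⟨ n ∷ [] , + 0 ⟩
    same-val : ∀ i → val (n ∷ s) i ≡ seqOf ((g ⁻¹) · ⟨ s , n ⟩) i
    same-val i = sym (begin
      seqOf ((g ⁻¹) · ⟨ s , n ⟩) i               ≡⟨ seq-⁻¹· (n ∷ []) (+ 0) s n i ⟩
      val (n ∷ []) (i + + 0) xor val s (i + + 0) ≡⟨ cong (λ j → val (n ∷ []) j xor val s j) (ℤP.+-identityʳ i) ⟩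
      (does (n ≟ i) xor false) xor val s i       ≡⟨ cong (_xor val s i) (xor-identityʳ (does (n ≟ i))) ⟩
      val (n ∷ s) i                              ∎)
      where open ≡-Reasoning
    flipped-true : x ⟨ n ∷ s , n ⟩ ≡ true
    flipped-true = trans (x-cong {v = sup ((g ⁻¹) · ⟨ s , n ⟩)} same-val (sym (ℤP.+-identityˡ n)))
                         (trans (fixed g ⟨ s , n ⟩) e)

  module Reconstruction {s₀ n₀} (true₀ : x ⟨ s₀ , n₀ ⟩ ≡ true) where

    level : ℕ → ℤ
    level d = n₀ - + d

    level-suc : ∀ d → level (suc d) + + 1 ≡ level d
    level-suc d = trans (cong (λ j → (n₀ - j) + + 1) (ℤP.pos-+ 1 d)) (e n₀ (+ d))
      where e : ∀ n j → (n - (+ 1 + j)) + + 1 ≡ n - j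
            e = solve-∀

    level-antitone : ∀ {d e} → d ≤ℕ e → level e ≤ level d
    level-antitone d≤e = ℤP.+-monoʳ-≤ n₀ (ℤP.neg-mono-≤ (+≤+ d≤e))

    level-≤ : ∀ {i d} → n₀ ≤ i + + d → level d ≤ i
    level-≤ {i} {d} p = subst (level d ≤_) (e i (+ d)) (ℤP.+-monoˡ-≤ (- + d) p)
      where e : ∀ i j → (i + j) - j ≡ i
            e = solve-∀

    path : ℕ → List ℤ
    path zero    = s₀
    path (suc d) = if x ⟨ path d , level (suc d) ⟩ then path d else level (suc d) ∷ path d

    path-true : ∀ d → x ⟨ path d , level d ⟩ ≡ true
    path-true zero = trans (x-cong (λ _ → refl) (ℤP.+-identityʳ n₀)) true₀
    path-true (suc d) with x ⟨ path d , level (suc d) ⟩ in e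
    ... | true  = e
    ... | false with lower (trans (x-cong (λ _ → refl) (level-suc d)) (path-true d))
    ...   | inj₁ h = contradiction (trans (sym e) h) λ ()
    ...   | inj₂ h = h

    path-step : ∀ d → AgreeFrom (level d) (val (path (suc d))) (val (path d))
    path-step d with x ⟨ path d , level (suc d) ⟩
    ... | true  = λ _ _ → refl
    ... | false = agree-cong (λ _ → refl) (level-suc d) (flipAt-agree (level (suc d)) (val (path d)))

    path-stable : ∀ k d → AgreeFrom (level d) (val (path (k +ℕ d))) (val (path d))
    path-stable zero    d = λ _ _ → refl
    path-stable (suc k) d = agree-trans (agree-mono (level-antitone (ℕP.m≤n+m d k)) (path-step (k +ℕ d)))
                                        (path-stable k d)

    depth : ℤ → ℕ
    depth i = proj₁ (∃≤+ n₀ i)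

    level-depth : ∀ i → level (depth i) ≤ i
    level-depth i = level-≤ (proj₂ (∃≤+ n₀ i))

    t : Seq
    t i = val (path (depth i)) i

    path-agrees : ∀ d → AgreeFrom (level d) (val (path d)) t
    path-agrees d i p with ℕP.≤-total d (depth i)
    ... | inj₁ d≤D = sym (subst (λ e → val (path e) i ≡ val (path d) i) (ℕP.m∸n+n≡m d≤D)
                                (path-stable (depth i ∸ d) d i p))
    ... | inj₂ D≤d = subst (λ e → val (path e) i ≡ val (path (depth i)) i) (ℕP.m∸n+n≡m D≤d)
                           (path-stable (d ∸ depth i) (depth i) i (level-depth i))

    t-vanishes : VanishesFrom (supportBound s₀ ⊔ n₀) t
    t-vanishes = agree-trans (agree-sym (agree-mono n₀≤ (path-agrees 0)))
                             (agree-mono (ℤP.i≤i⊔j (supportBound s₀) n₀) (val-vanishes s₀))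
      where n₀≤ = ℤP.≤-trans (ℤP.≤-reflexive (ℤP.+-identityʳ n₀)) (ℤP.i≤j⊔i (supportBound s₀) n₀)

    true-if-agrees : ∀ {s n} → AgreeFrom n (val s) t → x ⟨ s , n ⟩ ≡ true
    true-if-agrees {s} {n} A =
      tail-determines (agree-trans (agree-mono (level-depth n) (path-agrees (depth n))) (agree-sym A))
                      (raise* (level-depth n) (path-true (depth n)))

    agrees-if-true : ∀ {s n} → x ⟨ s , n ⟩ ≡ true → AgreeFrom n (val s) t
    agrees-if-true {s} {n} = downward-induction {P} M base step n
      where
      M = supportBound s ⊔ (supportBound s₀ ⊔ n₀)
      P : ℤ → Set
      P m = x ⟨ s , m ⟩ ≡ true → AgreeFrom m (val s) t
      base : ∀ m → M ≤ m → P m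
      base m M≤m _ = agree-mono M≤m (agree-trans (agree-mono (ℤP.i≤i⊔j _ _) (val-vanishes s))
                                                 (agree-sym (agree-mono (ℤP.i≤j⊔i _ _) t-vanishes)))
      step : ∀ m → P (m + + 1) → P m
      step m ih h with to agree-suc⇔ (ih (raise h))
      ... | inj₁ A = A
      ... | inj₂ B = contradiction (trans (sym (flip-false h)) (true-if-agrees B)) λ ()

    eta≡x : (em : ExcludedMiddle 0ℓ) → ∀ h → etaMap em t h ≡ x h
    eta≡x em ⟨ s , n ⟩ with x ⟨ s , n ⟩ in e
    ... | true  = eta-true em t ⟨ s , n ⟩ (agrees-if-true e)
    ... | false = eta-false em t ⟨ s , n ⟩ λ A → contradiction (trans (sym e) (true-if-agrees A)) λ ()

-- Surjectivity and almost minimality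

true-infSupp : RightInfSupp (λ _ → true)
true-infSupp (N , vanish) = contradiction (vanish N ℕP.≤-refl) λ ()

bot∈Ω← : Ω← botCfg
bot∈Ω← = (λ _ _ _ → refl) , λ _ → (λ ()) , (λ ())

module _ (em : ExcludedMiddle 0ℓ) where

  eta-surjective : ∀ x → Ω← x → ∃ λ t → ∀ h → etaMap em t h ≡ x h
  eta-surjective x x∈Ω with em {∃ λ h → x h ≡ true}
  ... | yes (_ , true₀) = t , eta≡x em
    where open InΩ←.Reconstruction x∈Ω true₀
  ... | no no-true = (λ _ → true) , λ h → trans (infSupp⇒bot em _ true-infSupp h) (sym (¬-not (λ e → no-true (h , e))))

  nonBot⇒rightFinSupp : ∀ t → ¬ IsBot (etaMap em t) → RightFinSupp t
  nonBot⇒rightFinSupp t nonBot = decidable-stable em (nonBot ∘ infSupp⇒bot em t)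

  orbit-reaches : ∀ x → Ω← x → ¬ IsBot x → ∀ t′ → RightFinSupp t′ → ∀ n →
                  ∃ λ g → ∀ h → n ≤ pos h → actCfg g x h ≡ etaMap em t′ h
  orbit-reaches x x∈Ω nonBot t′ t′-fin n = g , λ h n≤h → begin
    actCfg g x h               ≡⟨ sym (x≡ ((g ⁻¹) · h)) ⟩
    actCfg g (etaMap em t) h   ≡⟨ sym (eta-equivariant em g t h) ⟩
    etaMap em (actSeq g t) h   ≡⟨ eta-tail em h (agree-mono n≤h gt≈t′) ⟩
    etaMap em t′ h             ∎
    where
    open ≡-Reasoning
    t = proj₁ (eta-surjective x x∈Ω)
    x≡ = proj₂ (eta-surjective x x∈Ω)
    t-fin = nonBot⇒rightFinSupp t λ bot → nonBot λ h → trans (sym (x≡ h)) (bot h)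
    g = proj₁ (translate-tail t t′ t-fin t′-fin n)
    gt≈t′ = proj₂ (translate-tail t t′ t-fin t′-fin n)

  finSupp-representative : ∀ t′ (F : List L) → ∃ λ t → RightFinSupp t × (∀ {h} → h ∈ F → etaMap em t h ≡ etaMap em t′ h)
  finSupp-representative t′ F with em {RightFinSupp t′}
  ... | yes t′-fin = t′ , t′-fin , λ _ → refl
  ... | no t′-inf  = val (M ∷ []) , vanishes⇒rightFinSupp _ (val-vanishes (M ∷ [])) ,
                     λ {h} h∈F → trans (spike-false h h∈F) (sym (infSupp⇒bot em t′ t′-inf h))
    where
    M = proj₁ (upper-bound (λ h → supportBound (sup h) ⊔ pos h) F)
    M-bound = proj₂ (upper-bound (λ h → supportBound (sup h) ⊔ pos h) F)
    spike-false : ∀ h → h ∈ F → etaMap em (val (M ∷ [])) h ≡ false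
    spike-false ⟨ s , n ⟩ h∈F = eta-false em _ ⟨ s , n ⟩ λ A → contradiction (begin
      true                   ≡⟨ cong (_xor false) (sym (dec-true (M ≟ M) refl)) ⟩
      val (M ∷ []) M         ≡⟨ sym (A M (ℤP.≤-trans (ℤP.i≤j⊔i _ n) (M-bound h∈F))) ⟩
      val s M                ≡⟨ val-vanishes s M (ℤP.≤-trans (ℤP.i≤i⊔j _ n) (M-bound h∈F)) ⟩
      false                  ∎) λ ()
      where open ≡-Reasoning

  dense-orbit : ∀ x → Ω← x → ¬ IsBot x → DenseOrbit x
  dense-orbit x x∈Ω nonBot y y∈Ω F = g , λ h h∈F → begin
    actCfg g x h     ≡⟨ g-moves h (proj₂ (lower-bound pos F) h∈F) ⟩
    etaMap em t h    ≡⟨ t≈t′ h∈F ⟩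
    etaMap em t′ h   ≡⟨ y≡ h ⟩
    y h              ∎
    where
    open ≡-Reasoning
    t′ = proj₁ (eta-surjective y y∈Ω)
    y≡ = proj₂ (eta-surjective y y∈Ω)
    t = proj₁ (finSupp-representative t′ F)
    t≈t′ = proj₂ (proj₂ (finSupp-representative t′ F))
    reach = orbit-reaches x x∈Ω nonBot t (proj₁ (proj₂ (finSupp-representative t′ F))) (proj₁ (lower-bound pos F))
    g = proj₁ reach
    g-moves = proj₂ reach

lemma6p2 : (em : ExcludedMiddle 0ℓ) →
    -- equivariance
    (∀ g t h → etaMap em (actSeq g t) h ≡ actCfg g (etaMap em t) h)
    -- image lies in Ω←, and every point of Ω← is attained
    × (∀ t → Ω← (etaMap em t))
    × (∀ x → Ω← x → ∃ λ t → ∀ h → etaMap em t h ≡ x h)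
    -- t_{>0} infinitely supported ⇒ η(t) = ⊥^L
    × (∀ t → RightInfSupp t → IsBot (etaMap em t))
    -- injective on {t : t_{>0} finitely supported}
    × (∀ t t′ → RightFinSupp t → RightFinSupp t′ →
         (∀ h → etaMap em t h ≡ etaMap em t′ h) → ∀ i → t i ≡ t′ i)
    -- Ω← is almost minimal
    × AlmostMinimal
lemma6p2 em =
  eta-equivariant em , eta∈Ω← em , eta-surjective em , infSupp⇒bot em , eta-injective em ,
  bot∈Ω← , (λ _ _ → refl) , (λ _ x∈Ω → InΩ←.fixed⇒bot x∈Ω) , dense-orbit em
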